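{- Let $s$ and $n\ge2$ be positive integers and $0\le k\le n$. Then $$[F(s,n,k;q)]_{q=-1}=\begin{cases}\binom{s(n-1)+k}{k}\binom{n}{k}+\binom{s(n-1)+k-1}{k}\binom{n-2}{k-2} & \text{if } n \text{ even},\\[2pt] \binom{s(n-1)+k}{k}\binom{n-2}{k}+\binom{s(n-1)+k-1}{k-1}\binom{n-2}{k-2}&\text{otherwise.}\end{cases}$$
   Context: $F(s,n,k;q)={s(n-1)+k\brack k}_{q^2}{n-1\brack k}_{q^2}+{s(n-1)+k\brack k}_{q^2}{n-2\brack k-1}_{q^2}q^n+{s(n-1)+k\brack k}_{q^2}{n-2\brack k-2}_{q^2}+{s(n-1)+k-1\brack k}_{q^2}{n-2\brack k-2}_{q^2}q^n$, where ${m\brack i}_{q^2}$ is the Gaussian binomial coefficient ${m\brack i}_q=\frac{[m]!_q}{[i]!_q[m-i]!_q}$ (zero if $i<0$ or $i>m$) with $q$ replaced by $q^2$, $[m]_q=1+\cdots+q^{m-1}$. Ordinary binomial coefficients $\binom{a}{b}$ are zero for $b<0$ or $b>a$. -}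

module Defs where

open import Data.Nat as ℕ using (ℕ; zero; suc)
open import Data.Nat.Combinatorics using (_C_)
open import Data.Integer using (ℤ; +_; -[1+_]; _+_; _*_; _^_; -_; _-_)

-- Gaussian binomial coefficient [m choose i]_q, as a polynomial in q
-- evaluated at the integer q (defined by the q-Pascal recurrence
-- [m+1 choose i+1] = [m choose i] + q^(i+1) [m choose i+1]);
-- zero for i > m.
gauss : ℤ → ℕ → ℕ → ℤ
gauss q zero    zero    = + 1
gauss q zero    (suc i) = + 0
gauss q (suc m) zero    = + 1
gauss q (suc m) (suc i) = gauss q m i + (q ^ suc i) * gauss q m (suc i)

gaussℤ : ℤ → ℕ → ℤ → ℤ
gaussℤ q m (+ i)    = gauss q m i
gaussℤ q m -[1+ _ ] = + 0

binomℤ : ℕ → ℤ → ℤ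
binomℤ a (+ b)    = + (a C b)
binomℤ a -[1+ _ ] = + 0

F : ℕ → ℕ → ℕ → ℤ → ℤ
F s n k q =
    gaussℤ q² A (+ k) * gaussℤ q² (n ℕ.∸ 1) (+ k)
  + gaussℤ q² A (+ k) * gaussℤ q² (n ℕ.∸ 2) (+ k - + 1) * q ^ n
  + gaussℤ q² A (+ k) * gaussℤ q² (n ℕ.∸ 2) (+ k - + 2)
  + gaussℤ q² (A ℕ.∸ 1) (+ k) * gaussℤ q² (n ℕ.∸ 2) (+ k - + 2) * q ^ n
  where
    q² : ℤ
    q² = q * q
    A : ℕ
    A = s ℕ.* (n ℕ.∸ 1) ℕ.+ k

-- At q = −1 we have q² = 1, so every Gaussian binomial in q² becomes an
-- ordinary binomial coefficient and qⁿ becomes the sign (−1)ⁿ.  For n even,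
-- Pascal's rule applied twice merges C(n−1,k) + C(n−2,k−1) + C(n−2,k−2) into
-- C(n,k).  For n odd, Pascal's rule C(n−1,k) = C(n−2,k) + C(n−2,k−1) cancels
-- the term with the minus sign, and C(A,k) − C(A−1,k) = C(A−1,k−1) for
-- A = s(n−1)+k ≥ 1 turns the remaining pair into the second summand.
module Submission where

open import Defs
open import Data.Nat as ℕ using (ℕ; _≤_; _∸_)
open import Data.Nat.Divisibility using (_∣_)
open import Data.Integer using (ℤ; +_; -[1+_]; _+_; _*_; _-_)
open import Data.Product using (_×_)
open import Relation.Nullary using (¬_)
open import Relation.Binary.PropositionalEquality using (_≡_)

open import Function using (_∘_)
open import Data.Nat using (zero; suc; _<_; s≤s; z≤n; _%_; _/_)
open import Data.Nat.Combinatorics using (_C_; nCk+nC[k+1]≡[n+1]C[k+1])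
open import Data.Nat.DivMod using (m≡m%n+[m/n]*n; m%n<n)
open import Data.Nat.Divisibility using (n∣m⇒m%n≡0; m%n≡0⇒n∣m)
import Data.Nat.Properties as ℕ
open import Data.Integer using (1ℤ; -1ℤ; _^_)
open import Data.Integer.Properties
  using (pos-+; +-comm; +-assoc; *-identityˡ; *-identityʳ; ^-zeroˡ; ^-distribˡ-+-*; ^-*-assoc)
open import Data.Integer.Tactic.RingSolver using (solve-∀)
open import Data.Product using (_,_)
open import Relation.Nullary using (contradiction)
open import Relation.Binary.PropositionalEquality using (refl; sym; trans; cong; cong₂; module ≡-Reasoning)
open ≡-Reasoning

pascalℤ : ∀ n k → + (suc n C suc k) ≡ + (n C k) + + (n C suc k)
pascalℤ n k = trans (cong +_ (sym (nCk+nC[k+1]≡[n+1]C[k+1] n k))) (pos-+ (n C k) (n C suc k))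

gauss-one : ∀ m i → gauss 1ℤ m i ≡ + (m C i)
gauss-one zero    zero    = refl
gauss-one zero    (suc i) = refl
gauss-one (suc m) zero    = refl
gauss-one (suc m) (suc i) = begin
  gauss 1ℤ m i + 1ℤ ^ suc i * gauss 1ℤ m (suc i)
    ≡⟨ cong (λ t → gauss 1ℤ m i + t * gauss 1ℤ m (suc i)) (^-zeroˡ (suc i)) ⟩
  gauss 1ℤ m i + 1ℤ * gauss 1ℤ m (suc i)
    ≡⟨ cong (λ t → gauss 1ℤ m i + t) (*-identityˡ (gauss 1ℤ m (suc i))) ⟩
  gauss 1ℤ m i + gauss 1ℤ m (suc i)
    ≡⟨ cong₂ _+_ (gauss-one m i) (gauss-one m (suc i)) ⟩
  + (m C i) + + (m C suc i)
    ≡⟨ pascalℤ m i ⟨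
  + (suc m C suc i) ∎

gaussℤ-one : ∀ m j → gaussℤ 1ℤ m j ≡ binomℤ m j
gaussℤ-one m (+ i)    = gauss-one m i
gaussℤ-one m -[1+ _ ] = refl

binomℤ-pascal : ∀ a i → binomℤ (suc a) i ≡ binomℤ a i + binomℤ a (i - + 1)
binomℤ-pascal a (+ zero)  = refl
binomℤ-pascal a (+ suc k) = trans (pascalℤ a k) (+-comm (+ (a C k)) (+ (a C suc k)))
binomℤ-pascal a -[1+ _ ]  = refl

binomℤ-pascal₂ : ∀ a i →
  binomℤ (suc (suc a)) i ≡ binomℤ (suc a) i + (binomℤ a (i - + 1) + binomℤ a (i - + 2))
binomℤ-pascal₂ a i = begin
  binomℤ (suc (suc a)) i
    ≡⟨ binomℤ-pascal (suc a) i ⟩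
  binomℤ (suc a) i + binomℤ (suc a) (i - + 1)
    ≡⟨ cong (λ t → binomℤ (suc a) i + t) (binomℤ-pascal a (i - + 1)) ⟩
  binomℤ (suc a) i + (binomℤ a (i - + 1) + binomℤ a (i - + 1 - + 1))
    ≡⟨ cong (λ j → binomℤ (suc a) i + (binomℤ a (i - + 1) + binomℤ a j)) (+-assoc i -1ℤ -1ℤ) ⟩
  binomℤ (suc a) i + (binomℤ a (i - + 1) + binomℤ a (i - + 2)) ∎

-1^[2*q]≡1 : ∀ q → -1ℤ ^ (2 ℕ.* q) ≡ 1ℤ
-1^[2*q]≡1 q = trans (sym (^-*-assoc -1ℤ 2 q)) (^-zeroˡ q)

-1^n≡-1^[n%2] : ∀ n → -1ℤ ^ n ≡ -1ℤ ^ (n % 2)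
-1^n≡-1^[n%2] n = begin
  -1ℤ ^ n                          ≡⟨ cong (-1ℤ ^_) (m≡m%n+[m/n]*n n 2) ⟩
  -1ℤ ^ (n % 2 ℕ.+ n / 2 ℕ.* 2)     ≡⟨ ^-distribˡ-+-* -1ℤ (n % 2) (n / 2 ℕ.* 2) ⟩
  -1ℤ ^ (n % 2) * -1ℤ ^ (n / 2 ℕ.* 2)
    ≡⟨ cong (λ e → -1ℤ ^ (n % 2) * -1ℤ ^ e) (ℕ.*-comm (n / 2) 2) ⟩
  -1ℤ ^ (n % 2) * -1ℤ ^ (2 ℕ.* (n / 2))
    ≡⟨ cong (-1ℤ ^ (n % 2) *_) (-1^[2*q]≡1 (n / 2)) ⟩
  -1ℤ ^ (n % 2) * 1ℤ               ≡⟨ *-identityʳ (-1ℤ ^ (n % 2)) ⟩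
  -1ℤ ^ (n % 2) ∎

-1^even : ∀ {n} → 2 ∣ n → -1ℤ ^ n ≡ 1ℤ
-1^even {n} 2∣n = trans (-1^n≡-1^[n%2] n) (cong (-1ℤ ^_) (n∣m⇒m%n≡0 n 2 2∣n))

-1^odd : ∀ {n} → ¬ (2 ∣ n) → -1ℤ ^ n ≡ -1ℤ
-1^odd {n} 2∤n =
  trans (-1^n≡-1^[n%2] n) (nonzero-bit (n % 2) (m%n<n n 2) (2∤n ∘ m%n≡0⇒n∣m n 2))
  where
  nonzero-bit : ∀ r → r < 2 → ¬ (r ≡ 0) → -1ℤ ^ r ≡ -1ℤ
  nonzero-bit zero          _ r≢0 = contradiction refl r≢0
  nonzero-bit (suc zero)    _ _   = refl
  nonzero-bit (suc (suc _)) (s≤s (s≤s ())) _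

F-at-minus-one : ∀ s n k → let A = s ℕ.* (n ∸ 1) ℕ.+ k in
  F s n k -1ℤ ≡
      binomℤ A (+ k) * binomℤ (n ∸ 1) (+ k)
    + binomℤ A (+ k) * binomℤ (n ∸ 2) (+ k - + 1) * -1ℤ ^ n
    + binomℤ A (+ k) * binomℤ (n ∸ 2) (+ k - + 2)
    + binomℤ (A ∸ 1) (+ k) * binomℤ (n ∸ 2) (+ k - + 2) * -1ℤ ^ n
F-at-minus-one s n k =
  cong₂ _+_
    (cong₂ _+_
      (cong₂ _+_
        (cong₂ _*_ (g A (+ k)) (g (n ∸ 1) (+ k)))
        (cong (_* -1ℤ ^ n) (cong₂ _*_ (g A (+ k)) (g (n ∸ 2) (+ k - + 1)))))
      (cong₂ _*_ (g A (+ k)) (g (n ∸ 2) (+ k - + 2))))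
    (cong (_* -1ℤ ^ n) (cong₂ _*_ (g (A ∸ 1) (+ k)) (g (n ∸ 2) (+ k - + 2))))
  where
  A : ℕ
  A = s ℕ.* (n ∸ 1) ℕ.+ k
  g : ∀ m j → gaussℤ 1ℤ m j ≡ binomℤ m j
  g = gaussℤ-one

collect-even : ∀ a b x y z →
  a * x + a * y * 1ℤ + a * z + b * z * 1ℤ ≡ a * (x + (y + z)) + b * z
collect-even = solve-∀

collect-odd : ∀ b c w y z →
  (b + c) * (w + y) + (b + c) * y * -1ℤ + (b + c) * z + b * z * -1ℤ ≡ (b + c) * w + c * z
collect-odd = solve-∀

proposition5p2 : (s n k : ℕ) → 1 ≤ s → 2 ≤ n → k ≤ n →
    ((2 ∣ n → F s n k -[1+ 0 ] ≡
        binomℤ (s ℕ.* (n ∸ 1) ℕ.+ k) (+ k) * binomℤ n (+ k)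
        + binomℤ (s ℕ.* (n ∸ 1) ℕ.+ k ∸ 1) (+ k) * binomℤ (n ∸ 2) (+ k - + 2))
    × (¬ (2 ∣ n) → F s n k -[1+ 0 ] ≡
        binomℤ (s ℕ.* (n ∸ 1) ℕ.+ k) (+ k) * binomℤ (n ∸ 2) (+ k)
        + binomℤ (s ℕ.* (n ∸ 1) ℕ.+ k ∸ 1) (+ k - + 1) * binomℤ (n ∸ 2) (+ k - + 2)))
proposition5p2 (suc s) (suc (suc m)) k (s≤s z≤n) (s≤s (s≤s z≤n)) _ = even , odd
  where
  -- A = s(n−1)+k reduces to suc A′ once s and n are successors, so A ∸ 1 is A′.
  A′ : ℕ
  A′ = m ℕ.+ s ℕ.* suc m ℕ.+ k
  a b c w x y z : ℤ
  a = binomℤ (suc A′) (+ k)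
  b = binomℤ A′ (+ k)
  c = binomℤ A′ (+ k - + 1)
  w = binomℤ m (+ k)
  x = binomℤ (suc m) (+ k)
  y = binomℤ m (+ k - + 1)
  z = binomℤ m (+ k - + 2)

  even : 2 ∣ suc (suc m) → F (suc s) (suc (suc m)) k -1ℤ ≡ a * binomℤ (suc (suc m)) (+ k) + b * z
  even 2∣n = begin
    F (suc s) (suc (suc m)) k -1ℤ ≡⟨ F-at-minus-one (suc s) (suc (suc m)) k ⟩
    _                             ≡⟨ cong (λ σ → a * x + a * y * σ + a * z + b * z * σ) (-1^even 2∣n) ⟩
    _                             ≡⟨ collect-even a b x y z ⟩
    a * (x + (y + z)) + b * z     ≡⟨ cong (λ t → a * t + b * z) (binomℤ-pascal₂ m (+ k)) ⟨
    a * binomℤ (suc (suc m)) (+ k) + b * z ∎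

  odd : ¬ (2 ∣ suc (suc m)) → F (suc s) (suc (suc m)) k -1ℤ ≡ a * w + c * z
  odd 2∤n = begin
    F (suc s) (suc (suc m)) k -1ℤ ≡⟨ F-at-minus-one (suc s) (suc (suc m)) k ⟩
    _                             ≡⟨ cong (λ σ → a * x + a * y * σ + a * z + b * z * σ) (-1^odd 2∤n) ⟩
    a * x + a * y * -1ℤ + a * z + b * z * -1ℤ
      ≡⟨ cong₂ (λ a x → a * x + a * y * -1ℤ + a * z + b * z * -1ℤ)
               (binomℤ-pascal A′ (+ k)) (binomℤ-pascal m (+ k)) ⟩
    _                             ≡⟨ collect-odd b c w y z ⟩
    (b + c) * w + c * z           ≡⟨ cong (λ a → a * w + c * z) (binomℤ-pascal A′ (+ k)) ⟨
    a * w + c * z ∎
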